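{- For every integer $q\geq 2$, the graph $G(q)$ has no $(7,1)$-partition.
   Context: For $q\in\mathbb{N}$, $G(q)$ is the graph with vertex set $\{v_j^i: 1\le i\le 2q+1,\ 1\le j\le 6\}$ obtained as follows. For each $i$, the vertices $v_1^i,\dots,v_6^i$ induce a complete graph $K_6$. In addition, for each $i\in\{2,\dots,2q+1\}$ the following edges between $\{v^i_1,\dots,v^i_6\}$ and $\{v^{i-1}_1,\dots,v^{i-1}_6\}$ are added (listing the neighbours of $v^i_j$ among the vertices $v^{i-1}_\ell$), and there are no other edges. If $i$ is even: $v_1^i$: none; $v_2^i$: $v_1^{i-1}$; $v_3^i$: $v_2^{i-1},v_3^{i-1}$; $v_4^i$: $v_1^{i-1},v_2^{i-1},v_3^{i-1}$; $v_5^i$: $v_1^{i-1},v_4^{i-1},v_5^{i-1},v_6^{i-1}$; $v_6^i$: $v_2^{i-1},v_3^{i-1},v_4^{i-1},v_5^{i-1},v_6^{i-1}$. If $i$ is odd: $v_1^i$: $v_2^{i-1},v_3^{i-1},v_4^{i-1},v_5^{i-1},v_6^{i-1}$; $v_2^i$: $v_1^{i-1},v_4^{i-1},v_5^{i-1},v_6^{i-1}$; $v_3^i$: $v_1^{i-1},v_2^{i-1},v_3^{i-1}$; $v_4^i$: $v_2^{i-1},v_3^{i-1}$; $v_5^i$: $v_1^{i-1}$; $v_6^i$: none. For $k,d\in\mathbb{N}$, a $(k,d)$-partition of a graph $G$ is a partition $S_1\cup\cdots\cup S_{\eta+1}$ of $V(G)$ such that $|S_1|\le k$, $|S_j|=k$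 for $j\in\{2,\dots,\eta+1\}$, and for each $j\in\{2,\dots,\eta+1\}$ there is an ordering $x_1^j,\dots,x_k^j$ of $S_j$ with $|N_G(x_i^j)\cap(S_1\cup\cdots\cup S_{j-1})|\le di-1$ for every $i\in\{1,\dots,k\}$, where $N_G(v)$ is the set of neighbours of $v$. -}

module Defs where

open import Data.Nat using (ℕ; zero; suc; _+_; _*_; _≤_; _≡ᵇ_)
open import Data.Bool using (Bool; true; false; not; _∧_; _∨_; if_then_else_)
open import Data.Fin using (Fin; toℕ)
open import Data.Product using (_×_; _,_)
open import Data.List using (List; []; _∷_; _++_; map; concat; concatMap; length; allFin)
open import Data.Bool.ListAction using (any)
open import Data.Vec using (Vec; toList; lookup)
open import Data.Unit using (⊤)
open import Data.List.Relation.Binary.Permutation.Propositional using (_↭_)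

countAdj : {V : Set} → (V → V → Bool) → V → List V → ℕ
countAdj adj x [] = 0
countAdj adj x (y ∷ ys) = (if adj x y then 1 else 0) + countAdj adj x ys

-- Ordering condition for the blocks S₂,…,S_{η+1} (each given as an
-- ordered vector x₁,…,x_k), where `prefix` lists S₁ ∪ … ∪ S_{j-1}.
-- Condition |N(x_i) ∩ prefix| ≤ d·i - 1 is written as  count + 1 ≤ d·i.
OrderedBlocks : {V : Set} → (V → V → Bool) → (k d : ℕ) →
                List V → List (Vec V k) → Set
OrderedBlocks adj k d prefix [] = ⊤
OrderedBlocks adj k d prefix (b ∷ bs) =
  ((i : Fin k) → countAdj adj (lookup b i) prefix + 1 ≤ d * suc (toℕ i))
  × OrderedBlocks adj k d (prefix ++ toList b) bs

-- The covering condition (the concatenation is a permutation of the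
-- vertex enumeration) says the sets are pairwise disjoint, duplicate-free,
-- and cover V(G).
record KDPartition {V : Set} (adj : V → V → Bool) (vertices : List V)
                   (k d : ℕ) : Set where
  field
    S₁      : List V
    blocks  : List (Vec V k)
    S₁-size : length S₁ ≤ k
    covers  : (S₁ ++ concat (map toList blocks)) ↭ vertices
    ordered : OrderedBlocks adj k d S₁ blocks

-- The graph G(q).  Vertex v^i_j (1 ≤ i ≤ 2q+1, 1 ≤ j ≤ 6) is encoded
-- as the pair (i-1 , j-1) : Fin (2q+1) × Fin 6.

GV : ℕ → Set
GV q = Fin (2 * q + 1) × Fin 6

GVertices : (q : ℕ) → List (GV q)
GVertices q = concatMap (λ i → map (λ j → (i , j)) (allFin 6)) (allFin (2 * q + 1))

-- crossNbrs evenUpper j : 0-based indices ℓ of the neighbours v^{i-1}_{ℓ+1}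
-- of v^i_{j+1}, where evenUpper says whether the (1-based) layer i is even.
crossNbrs : Bool → ℕ → List ℕ
crossNbrs true 0 = []
crossNbrs true 1 = 0 ∷ []
crossNbrs true 2 = 1 ∷ 2 ∷ []
crossNbrs true 3 = 0 ∷ 1 ∷ 2 ∷ []
crossNbrs true 4 = 0 ∷ 3 ∷ 4 ∷ 5 ∷ []
crossNbrs true 5 = 1 ∷ 2 ∷ 3 ∷ 4 ∷ 5 ∷ []
crossNbrs false 0 = 1 ∷ 2 ∷ 3 ∷ 4 ∷ 5 ∷ []
crossNbrs false 1 = 0 ∷ 3 ∷ 4 ∷ 5 ∷ []
crossNbrs false 2 = 0 ∷ 1 ∷ 2 ∷ []
crossNbrs false 3 = 1 ∷ 2 ∷ []
crossNbrs false 4 = 0 ∷ []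
crossNbrs false 5 = []
crossNbrs _ (suc (suc (suc (suc (suc (suc _)))))) = []

-- is a 1-based layer index even?  (1-based index = 0-based index + 1)
even1 : ℕ → Bool
even1 0 = false
even1 1 = true
even1 (suc (suc n)) = even1 n

crossAdj : ℕ → ℕ → ℕ → Bool
crossAdj a j ℓ = any (λ m → m ≡ᵇ ℓ) (crossNbrs (even1 a) j)

Gadj : (q : ℕ) → GV q → GV q → Bool
Gadj q (a , j) (b , ℓ) =
     ((toℕ a ≡ᵇ toℕ b) ∧ not (toℕ j ≡ᵇ toℕ ℓ))
  ∨ ((toℕ a ≡ᵇ suc (toℕ b)) ∧ crossAdj (toℕ a) (toℕ j) (toℕ ℓ))
  ∨ ((toℕ b ≡ᵇ suc (toℕ a)) ∧ crossAdj (toℕ b) (toℕ ℓ) (toℕ j))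

module Submission where

-- In a (7,1)-partition the first vertex of a block has no neighbour in the earlier
-- blocks and the i-th at most i − 1.  Let b′, b be the last two blocks (there are at
-- least two, since G(q) has at least 30 vertices).  Every vertex below the five top
-- layers has at least 7 neighbours in layers up to the next one, so the vertices that
-- matter lie in the top five layers, which induce a copy of G(2); all questions about
-- that copy are settled by computation.  The first vertex of b is v^{2q+1}_5 or
-- v^{2q+1}_6, whose closed neighbourhood is the whole top layer, so b is the top layer
-- plus one vertex y ∈ {v^{2q}_1, v^{2q}_2}.  The closed neighbourhood K of the first
-- vertex of b′ outside b then lies in b′, and some vertex of K has more neighbours
-- outside b ∪ K than its ≤ 6 earlier neighbours and the 7 − |K| free places of b′
-- allow.  The one exception (y = v^{2q}_2, first vertex v^{2q}_1) is refuted by the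
-- second vertex of b′, which has at most one earlier neighbour.

open import Defs
open import Data.Bool using (Bool; true; false; if_then_else_)
open import Data.Bool.ListAction using (any)
open import Data.Bool.Properties using () renaming (_≟_ to _≟ᵇ_)
open import Data.Empty using (⊥; ⊥-elim)
open import Data.Fin using (Fin; toℕ; fromℕ<; fromℕ; #_; zero; suc)
open import Data.Fin.Properties
  using (toℕ-fromℕ<; toℕ-fromℕ; toℕ-injective; toℕ<n) renaming (_≟_ to _≟ᶠ_)
open import Data.List
  using (List; []; _∷_; _++_; [_]; map; concat; concatMap; length; filter; cartesianProduct; allFin)
open import Data.List.Properties using (length-++; length-map; ++-identityʳ; ++-assoc)
open import Data.List.Membership.Propositional using (_∈_; _∉_; find)
open import Data.List.Membership.Propositional.Properties
  using ( ∈-∃++; ∈-++⁻; ∈-++⁺ˡ; ∈-++⁺ʳ; ∈-map⁺; ∈-map⁻; ∈-filter⁺; ∈-filter⁻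
        ; ∈-cartesianProduct⁺; ∈-allFin)
import Data.List.Membership.DecPropositional as MembershipDec
open import Data.List.Relation.Binary.Subset.Propositional using (_⊆_)
open import Data.List.Relation.Binary.Permutation.Propositional as ↭ using (_↭_; ↭-sym; ↭⇒↭ₛ)
open import Data.List.Relation.Binary.Permutation.Propositional.Properties using (shift; ∈-resp-↭; ↭-length)
import Data.List.Relation.Binary.Permutation.Setoid.Properties as PermutationSetoid
open import Data.List.Relation.Unary.All as All using (All; []; _∷_; all?)
import Data.List.Relation.Unary.All.Properties as All
open import Data.List.Relation.Unary.Any using (Any; here; there; any?)
open import Data.List.Relation.Unary.Unique.Propositional using (Unique; []; _∷_)
open import Data.List.Relation.Unary.Unique.Propositional.Properties
  using (++⁺; map⁺; filter⁺; cartesianProduct⁺; allFin⁺)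
import Data.List.Relation.Unary.Unique.DecPropositional as UniqueDec
open import Data.Nat using (ℕ; zero; suc; _+_; _*_; _∸_; _≤_; _<_; z≤n; s≤s; _≡ᵇ_; _≤?_; _<?_)
open import Data.Nat.Properties
open import Data.Product using (∃; ∃₂; _×_; _,_; proj₁; proj₂)
open import Data.Product.Properties using (≡-dec)
open import Data.Sum using (_⊎_; inj₁; inj₂)
open import Data.Vec using (Vec; toList; lookup; _∷_)
open import Data.Vec.Properties using (length-toList)
open import Data.Vec.Membership.Propositional.Properties using (∈-lookup; ∈-toList⁺; ∈-toList⁻)
open import Data.Vec.Relation.Unary.Any using (index)
open import Data.Vec.Relation.Unary.Any.Properties using (lookup-index)
open import Function using (_∘_)
open import Relation.Binary.Definitions using (DecidableEquality)
open import Relation.Binary.PropositionalEquality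
  using (_≡_; _≢_; refl; sym; cong; cong₂; subst; subst₂; setoid; module ≡-Reasoning)
  renaming (trans to ≡-trans)
open import Relation.Nullary using (¬_; Dec; yes; no; ¬?; _×-dec_; _⊎-dec_; _→-dec_)
open import Relation.Nullary.Decidable using (True; toWitness; from-yes)
open import Relation.Unary using (Decidable)

-- Counting neighbours in lists

module _ {V : Set} (adj : V → V → Bool) (x : V) where

  indicator : V → ℕ
  indicator y = if adj x y then 1 else 0

  countAdj-++ : ∀ xs ys → countAdj adj x (xs ++ ys) ≡ countAdj adj x xs + countAdj adj x ys
  countAdj-++ [] ys = refl
  countAdj-++ (y ∷ xs) ys =
    ≡-trans (cong (indicator y +_) (countAdj-++ xs ys)) (sym (+-assoc (indicator y) _ _))

  countAdj≤length : ∀ xs → countAdj adj x xs ≤ length xs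
  countAdj≤length [] = z≤n
  countAdj≤length (y ∷ xs) with adj x y
  ... | true  = s≤s (countAdj≤length xs)
  ... | false = m≤n⇒m≤1+n (countAdj≤length xs)

  countAdj-↭ : ∀ {xs ys} → xs ↭ ys → countAdj adj x xs ≡ countAdj adj x ys
  countAdj-↭ ↭.refl = refl
  countAdj-↭ (↭.prep y p) = cong (indicator y +_) (countAdj-↭ p)
  countAdj-↭ {y ∷ z ∷ xs} {_ ∷ _ ∷ ys} (↭.swap y z p) = begin
    indicator y + (indicator z + countAdj adj x xs)  ≡⟨ sym (+-assoc (indicator y) _ _) ⟩
    indicator y + indicator z + countAdj adj x xs    ≡⟨ cong₂ _+_ (+-comm (indicator y) _) (countAdj-↭ p) ⟩
    indicator z + indicator y + countAdj adj x ys    ≡⟨ +-assoc (indicator z) _ _ ⟩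
    indicator z + (indicator y + countAdj adj x ys)  ∎
    where open ≡-Reasoning
  countAdj-↭ (↭.trans p r) = ≡-trans (countAdj-↭ p) (countAdj-↭ r)

  countAdj-mono : ∀ {xs ys} → Unique xs → xs ⊆ ys → countAdj adj x xs ≤ countAdj adj x ys
  countAdj-mono {[]} _ _ = z≤n
  countAdj-mono {u ∷ xs} (u≢xs ∷ xs!) xs⊆ys with ∈-∃++ (xs⊆ys (here refl))
  ... | ys₁ , ys₂ , refl = begin
    indicator u + countAdj adj x xs           ≤⟨ +-monoʳ-≤ _ (countAdj-mono xs! xs⊆ys₁++ys₂) ⟩
    indicator u + countAdj adj x (ys₁ ++ ys₂) ≡⟨ countAdj-↭ (↭-sym (shift u ys₁ ys₂)) ⟩
    countAdj adj x (ys₁ ++ [ u ] ++ ys₂)      ∎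
    where
      open ≤-Reasoning
      xs⊆ys₁++ys₂ : xs ⊆ ys₁ ++ ys₂
      xs⊆ys₁++ys₂ v∈xs with ∈-++⁻ ys₁ (xs⊆ys (there v∈xs))
      ... | inj₁ v∈ys₁ = ∈-++⁺ˡ v∈ys₁
      ... | inj₂ (here refl) = ⊥-elim (All.lookup u≢xs v∈xs refl)
      ... | inj₂ (there v∈ys₂) = ∈-++⁺ʳ ys₁ v∈ys₂

countAdj-const-true : ∀ {V : Set} (x : V) xs → countAdj (λ _ _ → true) x xs ≡ length xs
countAdj-const-true x [] = refl
countAdj-const-true x (y ∷ xs) = cong suc (countAdj-const-true x xs)

length-mono : ∀ {V : Set} {xs ys : List V} → Unique xs → xs ⊆ ys → length xs ≤ length ys
length-mono {xs = []} _ _ = z≤n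
length-mono {xs = x ∷ xs} {ys} xs! xs⊆ys =
  subst₂ _≤_ (countAdj-const-true x (x ∷ xs)) (countAdj-const-true x ys)
    (countAdj-mono (λ _ _ → true) x xs! xs⊆ys)

countAdj-map : ∀ {V W : Set} {adjV : V → V → Bool} {adjW : W → W → Bool} (f : V → W) {x} →
               (∀ y → adjW (f x) (f y) ≡ adjV x y) →
               ∀ ys → countAdj adjW (f x) (map f ys) ≡ countAdj adjV x ys
countAdj-map f f-adj [] = refl
countAdj-map f f-adj (y ∷ ys) rewrite f-adj y = cong (_ +_) (countAdj-map f f-adj ys)

countAdj-all : ∀ {V : Set} {adj : V → V → Bool} {x ys} → All (λ y → adj x y ≡ true) ys →
               countAdj adj x ys ≡ length ys
countAdj-all [] = refl
countAdj-all (x~y ∷ x~ys) rewrite x~y = cong suc (countAdj-all x~ys)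

length≤countAdj : ∀ {V : Set} {adj : V → V → Bool} {x ys zs} →
                  Unique ys → All (λ y → adj x y ≡ true) ys → ys ⊆ zs → length ys ≤ countAdj adj x zs
length≤countAdj {adj = adj} {x} ys! x~ys ys⊆zs =
  subst (_≤ _) (countAdj-all x~ys) (countAdj-mono adj x ys! ys⊆zs)

Unique-++⁻ : ∀ {V : Set} (xs : List V) {ys} → Unique (xs ++ ys) →
             Unique xs × Unique ys × (∀ {v} → v ∈ xs → v ∉ ys)
Unique-++⁻ [] ys! = [] , ys! , λ ()
Unique-++⁻ (x ∷ xs) (x∉ ∷ xs++ys!) with Unique-++⁻ xs xs++ys!
... | xs! , ys! , disjoint =
  All.tabulate (λ v∈xs → All.lookup x∉ (∈-++⁺ˡ v∈xs)) ∷ xs! , ys! , disjoint′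
  where
    disjoint′ : ∀ {v} → v ∈ x ∷ xs → v ∉ _
    disjoint′ (here refl) v∈ys = All.lookup x∉ (∈-++⁺ʳ xs v∈ys) refl
    disjoint′ (there v∈xs) = disjoint v∈xs

Unique-resp-↭ : ∀ {V : Set} {xs ys : List V} → xs ↭ ys → Unique xs → Unique ys
Unique-resp-↭ xs↭ys = PermutationSetoid.Unique-resp-↭ (setoid _) (↭⇒↭ₛ xs↭ys)

module Difference {V : Set} (_≟_ : DecidableEquality V) where
  open MembershipDec _≟_ using (_∈?_)

  infixl 5 _∖_
  _∖_ : List V → List V → List V
  xs ∖ ys = filter (λ v → ¬? (v ∈? ys)) xs

  ∈-∖⁻ : ∀ {v xs ys} → v ∈ xs ∖ ys → v ∈ xs × v ∉ ys
  ∈-∖⁻ {xs = xs} {ys} = ∈-filter⁻ (λ v → ¬? (v ∈? ys)) {xs = xs}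

  ∈-∖⁺ : ∀ {v xs ys} → v ∈ xs → v ∉ ys → v ∈ xs ∖ ys
  ∈-∖⁺ {ys = ys} = ∈-filter⁺ (λ v → ¬? (v ∈? ys))

  Unique-∖ : ∀ {xs} ys → Unique xs → Unique (xs ∖ ys)
  Unique-∖ ys = filter⁺ (λ v → ¬? (v ∈? ys))

  ⊆-++-∖ : ∀ xs ys → xs ⊆ ys ++ (xs ∖ ys)
  ⊆-++-∖ xs ys {v} v∈xs with v ∈? ys
  ... | yes v∈ys = ∈-++⁺ˡ v∈ys
  ... | no  v∉ys = ∈-++⁺ʳ ys (∈-∖⁺ v∈xs v∉ys)

  length-∖ : ∀ {xs ys} → Unique xs → Unique ys → ys ⊆ xs → length ys + length (xs ∖ ys) ≤ length xs
  length-∖ {xs} {ys} xs! ys! ys⊆xs = subst (_≤ length xs) (length-++ ys)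
    (length-mono (++⁺ ys! (Unique-∖ ys xs!) λ (v∈ys , v∈xs∖ys) → proj₂ (∈-∖⁻ {xs = xs} v∈xs∖ys) v∈ys)
                 ys++xs∖ys⊆xs)
    where
      ys++xs∖ys⊆xs : ys ++ (xs ∖ ys) ⊆ xs
      ys++xs∖ys⊆xs v∈ with ∈-++⁻ ys v∈
      ... | inj₁ v∈ys = ys⊆xs v∈ys
      ... | inj₂ v∈xs∖ys = proj₁ (∈-∖⁻ v∈xs∖ys)

  extra-element : ∀ {xs ys} → Unique xs → Unique ys → ys ⊆ xs → length xs ≡ suc (length ys) →
                  ∃ λ v → v ∈ xs × v ∉ ys × xs ⊆ v ∷ ys
  extra-element {xs} {ys} xs! ys! ys⊆xs len =
    from-rest (xs ∖ ys) (length-∖ xs! ys! ys⊆xs) (⊆-++-∖ xs ys) ∈-∖⁻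
    where
      from-rest : ∀ F → length ys + length F ≤ length xs → xs ⊆ ys ++ F →
                  (∀ {v} → v ∈ F → v ∈ xs × v ∉ ys) → ∃ λ v → v ∈ xs × v ∉ ys × xs ⊆ v ∷ ys
      from-rest [] _ xs⊆ys++[] _ = ⊥-elim (1+n≰n (subst (_≤ length ys) len (length-mono xs! xs⊆ys)))
        where
          xs⊆ys : xs ⊆ ys
          xs⊆ys v∈xs with ∈-++⁻ ys (xs⊆ys++[] v∈xs)
          ... | inj₁ v∈ys = v∈ys
      from-rest (v ∷ []) _ xs⊆ys++[v] v-new =
        v , proj₁ (v-new (here refl)) , proj₂ (v-new (here refl)) , xs⊆v∷ys
        where
          xs⊆v∷ys : xs ⊆ v ∷ ys
          xs⊆v∷ys w∈xs with ∈-++⁻ ys (xs⊆ys++[v] w∈xs)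
          ... | inj₁ w∈ys = there w∈ys
          ... | inj₂ (here refl) = here refl
      from-rest (u ∷ w ∷ F) size _ _ = ⊥-elim (1+n≰n (begin
        2 + length ys                  ≡⟨ +-comm 2 (length ys) ⟩
        length ys + 2                  ≤⟨ +-monoʳ-≤ (length ys) (s≤s (s≤s z≤n)) ⟩
        length ys + length (u ∷ w ∷ F) ≤⟨ size ⟩
        length xs                      ≡⟨ len ⟩
        1 + length ys                  ∎))
        where open ≤-Reasoning

∈-toList⇒lookup : ∀ {A : Set} {n} {xs : Vec A n} {v} → v ∈ toList xs → ∃ λ i → lookup xs i ≡ v
∈-toList⇒lookup v∈ = index (∈-toList⁻ v∈) , sym (lookup-index (∈-toList⁻ v∈))

lookup∈toList : ∀ {A : Set} {n} i (xs : Vec A n) → lookup xs i ∈ toList xs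
lookup∈toList i xs = ∈-toList⁺ (∈-lookup i xs)

lookup₀≢lookup₁ : ∀ {A : Set} {n} (xs : Vec A (suc (suc n))) → Unique (toList xs) →
                  lookup xs zero ≢ lookup xs (suc zero)
lookup₀≢lookup₁ (x ∷ y ∷ _) ((x≢y ∷ _) ∷ _) = x≢y

-- Blocks of a partition

record LastTwoBlocks {V : Set} (adj : V → V → Bool) (k d : ℕ) (vs : List V) : Set where
  field
    prefix           : List V
    penultimate last : Vec V k
    split            : prefix ++ toList penultimate ++ toList last ≡ vs
    penultimate-ok   : (i : Fin k) →
                       countAdj adj (lookup penultimate i) prefix + 1 ≤ d * suc (toℕ i)
    last-ok          : (i : Fin k) →
                       countAdj adj (lookup last i) (prefix ++ toList penultimate) + 1 ≤ d * suc (toℕ i)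

lastTwoBlocks : ∀ {V : Set} {adj : V → V → Bool} {k d} pre b₁ b₂ bs →
                OrderedBlocks adj k d pre (b₁ ∷ b₂ ∷ bs) →
                LastTwoBlocks adj k d (pre ++ concat (map toList (b₁ ∷ b₂ ∷ bs)))
lastTwoBlocks pre b₁ b₂ [] (ok₁ , ok₂ , _) = record
  { prefix = pre ; penultimate = b₁ ; last = b₂
  ; split = cong (λ l → pre ++ toList b₁ ++ l) (sym (++-identityʳ (toList b₂)))
  ; penultimate-ok = ok₁ ; last-ok = ok₂ }
lastTwoBlocks {adj = adj} {k} {d} pre b₁ b₂ (b₃ ∷ bs) (_ , ok) =
  subst (LastTwoBlocks adj k d) (++-assoc pre (toList b₁) _) (lastTwoBlocks (pre ++ toList b₁) b₂ b₃ bs ok)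

length-fewBlocks : ∀ {V : Set} {k} (S₁ : List V) (bs : List (Vec V k)) →
                   length S₁ ≤ k → length bs ≤ 1 →
                   length (S₁ ++ concat (map toList bs)) ≤ k + k
length-fewBlocks {k = k} S₁ [] S₁≤k _ = begin
  length (S₁ ++ [])  ≡⟨ cong length (++-identityʳ S₁) ⟩
  length S₁          ≤⟨ m≤n⇒m≤n+o k S₁≤k ⟩
  k + k              ∎
  where open ≤-Reasoning
length-fewBlocks {k = k} S₁ (b ∷ []) S₁≤k _ = begin
  length (S₁ ++ toList b ++ [])  ≡⟨ cong (λ l → length (S₁ ++ l)) (++-identityʳ (toList b)) ⟩
  length (S₁ ++ toList b)        ≡⟨ length-++ S₁ ⟩
  length S₁ + length (toList b)  ≡⟨ cong (length S₁ +_) (length-toList b) ⟩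
  length S₁ + k                  ≤⟨ +-monoˡ-≤ k S₁≤k ⟩
  k + k                          ∎
  where open ≤-Reasoning
length-fewBlocks S₁ (_ ∷ _ ∷ _) _ (s≤s ())

m+1≤1*[1+n]⇒m≤n : ∀ {m n} → m + 1 ≤ 1 * suc n → m ≤ n
m+1≤1*[1+n]⇒m≤n {m} {n} le = ≤-pred (subst₂ _≤_ (+-comm m 1) (+-identityʳ (suc n)) le)

-- The graph G(q) and its copies of G(2)

_≟ᵥ_ : ∀ {m} → DecidableEquality (Fin m × Fin 6)
_≟ᵥ_ = ≡-dec _≟ᶠ_ _≟ᶠ_

module _ {m : ℕ} where
  open Difference (_≟ᵥ_ {m}) public
  open MembershipDec (_≟ᵥ_ {m}) public using (_∈?_)

layer : ∀ {m} → Fin m × Fin 6 → ℕ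
layer = toℕ ∘ proj₁

GVertices≡cartesianProduct : ∀ {m} (is : List (Fin m)) →
  concatMap (λ i → map (λ j → (i , j)) (allFin 6)) is ≡ cartesianProduct is (allFin 6)
GVertices≡cartesianProduct [] = refl
GVertices≡cartesianProduct (i ∷ is) = cong (map (i ,_) (allFin 6) ++_) (GVertices≡cartesianProduct is)

GVertices-unique : ∀ q → Unique (GVertices q)
GVertices-unique q rewrite GVertices≡cartesianProduct (allFin (2 * q + 1)) =
  cartesianProduct⁺ (allFin⁺ _) (allFin⁺ 6)

∈-GVertices : ∀ q (v : GV q) → v ∈ GVertices q
∈-GVertices q (i , j) rewrite GVertices≡cartesianProduct (allFin (2 * q + 1)) =
  ∈-cartesianProduct⁺ (∈-allFin i) (∈-allFin j)

≡ᵇ-cancelˡ : ∀ m a b → (m + a ≡ᵇ m + b) ≡ (a ≡ᵇ b)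
≡ᵇ-cancelˡ zero    a b = refl
≡ᵇ-cancelˡ (suc m) a b = ≡ᵇ-cancelˡ m a b

≡ᵇ-suc-cancelˡ : ∀ m a b → (m + a ≡ᵇ suc (m + b)) ≡ (a ≡ᵇ suc b)
≡ᵇ-suc-cancelˡ zero    a b = refl
≡ᵇ-suc-cancelˡ (suc m) a b = ≡ᵇ-suc-cancelˡ m a b

even1-double : ∀ k a → even1 (k + k + a) ≡ even1 a
even1-double zero    a = refl
even1-double (suc k) a rewrite +-suc k k = even1-double k a

crossAdj-double : ∀ k a j ℓ → crossAdj (k + k + a) j ℓ ≡ crossAdj a j ℓ
crossAdj-double k a j ℓ = cong (λ e → any (λ m → m ≡ᵇ ℓ) (crossNbrs e j)) (even1-double k a)

halve : ∀ a → ∃₂ λ k r → r ≤ 1 × k + k + r ≡ a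
halve zero = 0 , 0 , z≤n , refl
halve (suc zero) = 0 , 1 , s≤s z≤n , refl
halve (suc (suc a)) with halve a
... | k , r , r≤1 , refl = suc k , r , r≤1 , cong (λ m → suc m + r) (+-suc k k)

-- `embed k` places G(2) on the (0-based) layers 2k, …, 2k+4 of G(2+p); since adjacency
-- depends only on the parity of layers, this is an induced copy.  `W` is the top copy.
module Window (p : ℕ) where

  q : ℕ
  q = suc (suc p)

  G : GV q → GV q → Bool
  G = Gadj q

  layer-count : p + p + 5 ≡ 2 * q + 1
  layer-count rewrite +-identityʳ p | +-suc p (suc p) | +-suc p p =
    ≡-trans (+-comm (p + p) 5) (cong (4 +_) (+-comm 1 (p + p)))

  embed : Fin (suc p) → GV 2 → GV q
  embed k (c , j) = fromℕ< bound , j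
    where
      k≤p : toℕ k ≤ p
      k≤p = ≤-pred (toℕ<n k)
      bound : toℕ k + toℕ k + toℕ c < 2 * q + 1
      bound = subst (toℕ k + toℕ k + toℕ c <_) layer-count (+-mono-≤-< (+-mono-≤ k≤p k≤p) (toℕ<n c))

  layer-embed : ∀ k x → layer (embed k x) ≡ toℕ k + toℕ k + layer x
  layer-embed k (c , j) = toℕ-fromℕ< _

  embed-onto : ∀ k c (a : Fin (2 * q + 1)) j →
               toℕ k + toℕ k + toℕ c ≡ toℕ a → embed k (c , j) ≡ (a , j)
  embed-onto k c a j eq = cong (_, j) (toℕ-injective (≡-trans (layer-embed k (c , j)) eq))

  embed-injective : ∀ k {x y} → embed k x ≡ embed k y → x ≡ y
  embed-injective k {c , j} {d , ℓ} eq with cong proj₂ eq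
  ... | refl = cong (_, j) (toℕ-injective (+-cancelˡ-≡ (toℕ k + toℕ k) _ _
         (≡-trans (sym (layer-embed k (c , j))) (≡-trans (cong layer eq) (layer-embed k (d , ℓ))))))

  Gadj-embed : ∀ k x y → G (embed k x) (embed k y) ≡ Gadj 2 x y
  Gadj-embed k (c , j) (d , ℓ)
    rewrite layer-embed k (c , j) | layer-embed k (d , ℓ)
          | ≡ᵇ-cancelˡ (toℕ k + toℕ k) (toℕ c) (toℕ d)
          | ≡ᵇ-suc-cancelˡ (toℕ k + toℕ k) (toℕ c) (toℕ d)
          | ≡ᵇ-suc-cancelˡ (toℕ k + toℕ k) (toℕ d) (toℕ c)
          | crossAdj-double (toℕ k) (toℕ c) (toℕ j) (toℕ ℓ)
          | crossAdj-double (toℕ k) (toℕ d) (toℕ ℓ) (toℕ j) = refl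

  top : Fin (suc p)
  top = fromℕ p

  W : GV 2 → GV q
  W = embed top

  layer-W : ∀ x → layer (W x) ≡ p + p + layer x
  layer-W x rewrite layer-embed top x | toℕ-fromℕ p = refl

  W-injective : ∀ {x y} → W x ≡ W y → x ≡ y
  W-injective = embed-injective top

  ∈-map-W⁻ : ∀ {x xs} → W x ∈ map W xs → x ∈ xs
  ∈-map-W⁻ Wx∈ with ∈-map⁻ W Wx∈
  ... | y , y∈xs , eq = subst (_∈ _) (sym (W-injective eq)) y∈xs

  lower-≢-W : ∀ k {x y} → toℕ k < p → layer x ≤ 2 → 3 ≤ layer y → embed k x ≢ W y
  lower-≢-W k {x} {y} k<p x≤2 3≤y eq = <-irrefl (cong layer eq) (begin-strict
    layer (embed k x)             ≡⟨ layer-embed k x ⟩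
    toℕ k + toℕ k + layer x       ≤⟨ +-monoʳ-≤ (toℕ k + toℕ k) x≤2 ⟩
    toℕ k + toℕ k + 2             ≡⟨ +-comm (toℕ k + toℕ k) 2 ⟩
    2 + (toℕ k + toℕ k)           ≡⟨ cong suc (sym (+-suc (toℕ k) (toℕ k))) ⟩
    suc (toℕ k) + suc (toℕ k)     ≤⟨ +-mono-≤ k<p k<p ⟩
    p + p                         <⟨ m<m+n (p + p) (≤-trans (s≤s z≤n) 3≤y) ⟩
    p + p + layer y               ≡⟨ sym (layer-W y) ⟩
    layer (W y)                   ∎)
    where open ≤-Reasoning

  vertex-cases : ∀ v → (∃ λ x → W x ≡ v) ⊎ (∃₂ λ k x → toℕ k < p × layer x ≤ 1 × embed k x ≡ v)
  vertex-cases (a , j) with p + p ≤? toℕ a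
  ... | yes 2p≤a = inj₁ ((fromℕ< r<5 , j) , embed-onto top (fromℕ< r<5) a j (begin
      toℕ top + toℕ top + toℕ (fromℕ< r<5)
        ≡⟨ cong₂ _+_ (cong₂ _+_ (toℕ-fromℕ p) (toℕ-fromℕ p)) (toℕ-fromℕ< r<5) ⟩
      p + p + (toℕ a ∸ (p + p))             ≡⟨ m+[n∸m]≡n 2p≤a ⟩
      toℕ a                                 ∎))
    where
      open ≡-Reasoning
      r<5 : toℕ a ∸ (p + p) < 5
      r<5 = m<n+o⇒m∸n<o (toℕ a) (p + p) (subst (toℕ a <_) (sym layer-count) (toℕ<n a))
  ... | no 2p≰a with halve (toℕ a)
  ...   | k , r , r≤1 , k+k+r≡a = inj₂ (fromℕ< k<1+p , (fromℕ< r<5 , j) , k′<p , r′≤1 ,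
            embed-onto (fromℕ< k<1+p) (fromℕ< r<5) a j (begin
      toℕ (fromℕ< k<1+p) + toℕ (fromℕ< k<1+p) + toℕ (fromℕ< r<5)
        ≡⟨ cong₂ _+_ (cong₂ _+_ (toℕ-fromℕ< k<1+p) (toℕ-fromℕ< k<1+p)) (toℕ-fromℕ< r<5) ⟩
      k + k + r  ≡⟨ k+k+r≡a ⟩
      toℕ a      ∎))
    where
      open ≡-Reasoning
      k<p : k < p
      k<p = ≰⇒> λ p≤k →
        2p≰a (subst (p + p ≤_) k+k+r≡a (≤-trans (+-mono-≤ p≤k p≤k) (m≤m+n (k + k) r)))
      k<1+p : k < suc p
      k<1+p = m≤n⇒m≤1+n k<p
      r<5 : r < 5
      r<5 = s≤s (≤-trans r≤1 (s≤s z≤n))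
      k′<p : toℕ (fromℕ< k<1+p) < p
      k′<p = subst (_< p) (sym (toℕ-fromℕ< k<1+p)) k<p
      r′≤1 : layer (fromℕ< r<5 , j) ≤ 1
      r′≤1 = subst (_≤ 1) (sym (toℕ-fromℕ< r<5)) r≤1

-- Finite facts about G(2), decided by computation.  Under the top copy `W`,
-- (# i , # j) stands for the vertex v^{2q-3+i}_{j+1} of G(q).

open UniqueDec (_≟ᵥ_ {2 * 2 + 1}) using (unique?)

all-by-decision : ∀ {A : Set} {P : A → Set} (P? : Decidable P) xs → {True (all? P? xs)} →
                  ∀ {x} → x ∈ xs → P x
all-by-decision P? xs {all-P} = All.lookup (toWitness all-P)

∀-by-decision : ∀ {P : GV 2 → Set} (P? : Decidable P) → {True (all? P? (GVertices 2))} → ∀ x → P x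
∀-by-decision P? {all-P} x = all-by-decision P? (GVertices 2) {all-P} (∈-GVertices 2 x)

degreeOutside : List (GV 2) → GV 2 → ℕ
degreeOutside X x = countAdj (Gadj 2) x (GVertices 2 ∖ X)

closedNbhdOutside : List (GV 2) → GV 2 → List (GV 2)
closedNbhdOutside X x = x ∷ filter (λ y → Gadj 2 x y ≟ᵇ true) (GVertices 2 ∖ X)

-- If W K lies in a block followed only by W R, no u ∈ K can have more neighbours outside
-- K and R than its at most 6 earlier neighbours and the 7 − |K| other places of the block.
Overloaded : List (GV 2) → List (GV 2) → Set
Overloaded R K = Unique K × Any (λ u → 6 + (7 ∸ length K) < degreeOutside (K ++ R) u) K

overloaded? : ∀ R K → Dec (Overloaded R K)
overloaded? R K = unique? K ×-dec any? (λ u → 6 + (7 ∸ length K) <? degreeOutside (K ++ R) u) K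

upperLayers : List (GV 2)
upperLayers = filter (λ d → 3 ≤? layer d) (GVertices 2)

layer≤2-outside-upper : ∀ {d} → d ∉ upperLayers → layer d ≤ 2
layer≤2-outside-upper {d} d∉ =
  ≤-pred (≰⇒> λ 3≤d → d∉ (∈-filter⁺ (λ d → 3 ≤? layer d) (∈-GVertices 2 d) 3≤d))

lowerCopy-degree : ∀ c → layer c ≤ 1 → 7 ≤ degreeOutside (c ∷ upperLayers) c
lowerCopy-degree = ∀-by-decision λ c → layer c ≤? 1 →-dec 7 ≤? degreeOutside (c ∷ upperLayers) c

topLayer : List (GV 2)
topLayer = map (# 4 ,_) (allFin 6)

topLayer-unique : Unique topLayer
topLayer-unique = from-yes (unique? topLayer)

topLayer-high : All (λ d → 3 ≤ layer d) topLayer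
topLayer-high = from-yes (all? (λ d → 3 ≤? layer d) topLayer)

lastStarts : List (GV 2)
lastStarts = (# 4 , # 4) ∷ (# 4 , # 5) ∷ []

lastStart-cases : ∀ c → degreeOutside [ c ] c ≤ 6 → c ∈ lastStarts
lastStart-cases = ∀-by-decision λ c → degreeOutside [ c ] c ≤? 6 →-dec c ∈? lastStarts

topLayer⊆closedNbhd : ∀ {c} → c ∈ lastStarts → All (_∈ closedNbhdOutside [] c) topLayer
topLayer⊆closedNbhd = all-by-decision (λ c → all? (_∈? closedNbhdOutside [] c) topLayer) lastStarts

lastExtras : List (GV 2)
lastExtras = (# 3 , # 0) ∷ (# 3 , # 1) ∷ []

lastExtra-cases : ∀ c → c ∉ topLayer → degreeOutside (c ∷ topLayer) c ≤ 6 → c ∈ lastExtras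
lastExtra-cases = ∀-by-decision λ c →
  ¬? (c ∈? topLayer) →-dec degreeOutside (c ∷ topLayer) c ≤? 6 →-dec c ∈? lastExtras

lastExtras-high : ∀ {y} → y ∈ lastExtras → All (λ d → 3 ≤ layer d) (y ∷ topLayer)
lastExtras-high = all-by-decision (λ y → all? (λ d → 3 ≤? layer d) (y ∷ topLayer)) lastExtras

exceptionalExtra exceptionalStart : GV 2
exceptionalExtra = (# 3 , # 1)
exceptionalStart = (# 3 , # 0)

penultimateStart-cases : ∀ {y} → y ∈ lastExtras → ∀ c → c ∉ y ∷ topLayer →
  degreeOutside (c ∷ y ∷ topLayer) c ≤ 6 →
  Overloaded (y ∷ topLayer) (closedNbhdOutside (y ∷ topLayer) c) ⊎ (y , c) ≡ (exceptionalExtra , exceptionalStart)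
penultimateStart-cases y∈ c = All.lookup (all-by-decision (λ y → all? (λ c →
    ¬? (c ∈? y ∷ topLayer) →-dec degreeOutside (c ∷ y ∷ topLayer) c ≤? 6 →-dec
    (overloaded? (y ∷ topLayer) (closedNbhdOutside (y ∷ topLayer) c) ⊎-dec
     ≡-dec _≟ᵥ_ _≟ᵥ_ (y , c) (exceptionalExtra , exceptionalStart))) (GVertices 2)) lastExtras y∈)
  (∈-GVertices 2 c)

exceptionalKnown : List (GV 2)
exceptionalKnown = exceptionalExtra ∷ topLayer

exceptionalNbhd : List (GV 2)
exceptionalNbhd = closedNbhdOutside exceptionalKnown exceptionalStart

exceptionalNbhd-unique : Unique exceptionalNbhd
exceptionalNbhd-unique = from-yes (unique? exceptionalNbhd)

exceptionalNbhd-high : All (λ d → 3 ≤ layer d) exceptionalNbhd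
exceptionalNbhd-high = from-yes (all? (λ d → 3 ≤? layer d) exceptionalNbhd)

commonLowerNbrs : List (GV 2)
commonLowerNbrs = (# 2 , # 1) ∷ (# 2 , # 2) ∷ []

commonLowerNbrs-unique : Unique commonLowerNbrs
commonLowerNbrs-unique = from-yes (unique? commonLowerNbrs)

commonLowerNbrs-unknown : All (_∉ exceptionalKnown) commonLowerNbrs
commonLowerNbrs-unknown = from-yes (all? (λ u → ¬? (u ∈? exceptionalKnown)) commonLowerNbrs)

commonLowerNbrs-overloaded : All (λ u → Overloaded exceptionalKnown (u ∷ exceptionalNbhd)) commonLowerNbrs
commonLowerNbrs-overloaded = from-yes (all? (λ u → overloaded? exceptionalKnown (u ∷ exceptionalNbhd)) commonLowerNbrs)

exceptional-outside : ∀ d → d ∉ exceptionalNbhd ++ exceptionalKnown →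
                      3 ≤ degreeOutside (d ∷ exceptionalNbhd ++ exceptionalKnown) d
exceptional-outside = ∀-by-decision λ d → ¬? (d ∈? exceptionalNbhd ++ exceptionalKnown) →-dec
                                          3 ≤? degreeOutside (d ∷ exceptionalNbhd ++ exceptionalKnown) d

exceptional-inside : ∀ {d} → d ∈ exceptionalNbhd → d ≡ exceptionalStart ⊎
  3 < degreeOutside (exceptionalNbhd ++ exceptionalKnown) d ⊎ All (λ u → Gadj 2 d u ≡ true) commonLowerNbrs
exceptional-inside = all-by-decision (λ d → d ≟ᵥ exceptionalStart ⊎-dec
                                            3 <? degreeOutside (exceptionalNbhd ++ exceptionalKnown) d ⊎-dec
                                            all? (λ u → Gadj 2 d u ≟ᵇ true) commonLowerNbrs)
                                     exceptionalNbhd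

-- Counting arguments inside one block

module PlacedBlock (p : ℕ) (Q : List (GV (suc (suc p)))) (β : Vec (GV (suc (suc p))) 7) (Rc : List (GV 2))
  (β-placed : ∀ i → countAdj (Gadj (suc (suc p))) (lookup β i) Q ≤ toℕ i)
  (β-unique : Unique (toList β))
  (covered  : ∀ v → v ∈ Q ⊎ v ∈ toList β ⊎ v ∈ map (Window.W p) Rc)
  (Rc-high  : All (λ d → 3 ≤ layer d) Rc)
  where

  open Window p

  placed≤6 : ∀ {v} → v ∈ toList β → countAdj G v Q ≤ 6
  placed≤6 v∈β with ∈-toList⇒lookup v∈β
  ... | i , refl = ≤-trans (β-placed i) (≤-pred (toℕ<n i))

  countAdj-budget : ∀ {K S} → Unique K → K ⊆ toList β →
                    Unique S → (∀ {u} → u ∈ S → u ∉ K × u ∉ map W Rc) →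
                    ∀ v → countAdj G v S ≤ countAdj G v Q + (7 ∸ length K)
  countAdj-budget {K} {S} K! K⊆β S! S-new v = begin
    countAdj G v S                        ≤⟨ countAdj-mono G v S! S⊆Q++rest ⟩
    countAdj G v (Q ++ rest)              ≡⟨ countAdj-++ G v Q rest ⟩
    countAdj G v Q + countAdj G v rest    ≤⟨ +-monoʳ-≤ _ (≤-trans (countAdj≤length G v rest) rest-size) ⟩
    countAdj G v Q + (7 ∸ length K)       ∎
    where
      open ≤-Reasoning
      rest : List (GV q)
      rest = toList β ∖ K
      rest-size : length rest ≤ 7 ∸ length K
      rest-size = m+n≤o⇒m≤o∸n (length rest) (subst (_≤ 7) (+-comm (length K) _)
                    (subst (length K + length rest ≤_) (length-toList β) (length-∖ β-unique K! K⊆β)))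
      S⊆Q++rest : S ⊆ Q ++ rest
      S⊆Q++rest {u} u∈S with covered u | S-new u∈S
      ... | inj₁ u∈Q         | _         = ∈-++⁺ˡ u∈Q
      ... | inj₂ (inj₁ u∈β)  | u∉K , _   = ∈-++⁺ʳ Q (∈-∖⁺ u∈β u∉K)
      ... | inj₂ (inj₂ u∈R)  | _ , u∉R   = ⊥-elim (u∉R u∈R)

  copy-budget : ∀ {K} k X → Unique K → K ⊆ toList β →
                (∀ {d} → d ∉ X → embed k d ∉ K × embed k d ∉ map W Rc) →
                ∀ x → degreeOutside X x ≤ countAdj G (embed k x) Q + (7 ∸ length K)
  copy-budget k X K! K⊆β new x =
    subst (_≤ _) (countAdj-map {adjV = Gadj 2} {adjW = G} (embed k) (Gadj-embed k x) (GVertices 2 ∖ X))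
      (countAdj-budget K! K⊆β (map⁺ (embed-injective k) (Unique-∖ X (GVertices-unique 2))) S-new (embed k x))
    where
      S-new : ∀ {u} → u ∈ map (embed k) (GVertices 2 ∖ X) → u ∉ _ × u ∉ map W Rc
      S-new u∈ with ∈-map⁻ (embed k) u∈
      ... | d , d∈ , refl = new (proj₂ (∈-∖⁻ d∈))

  window-budget : ∀ {Kc} → Unique Kc → map W Kc ⊆ toList β →
                  ∀ x → degreeOutside (Kc ++ Rc) x ≤ countAdj G (W x) Q + (7 ∸ length Kc)
  window-budget {Kc} Kc! Kc⊆β x =
    subst (λ l → degreeOutside (Kc ++ Rc) x ≤ countAdj G (W x) Q + (7 ∸ l)) (length-map W Kc)
      (copy-budget top (Kc ++ Rc) (map⁺ W-injective Kc!) Kc⊆β new x)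
    where
      new : ∀ {d} → d ∉ Kc ++ Rc → W d ∉ map W Kc × W d ∉ map W Rc
      new d∉ = (λ Wd∈ → d∉ (∈-++⁺ˡ (∈-map-W⁻ Wd∈)))
             , (λ Wd∈ → d∉ (∈-++⁺ʳ Kc (∈-map-W⁻ Wd∈)))

  ¬overloaded : ∀ {Kc} → map W Kc ⊆ toList β → ¬ Overloaded Rc Kc
  ¬overloaded {Kc} Kc⊆β (Kc! , heavy) with find heavy
  ... | u , u∈Kc , too-many = <⇒≱ too-many (begin
    degreeOutside (Kc ++ Rc) u            ≤⟨ window-budget Kc! Kc⊆β u ⟩
    countAdj G (W u) Q + (7 ∸ length Kc)  ≤⟨ +-monoˡ-≤ _ (placed≤6 (Kc⊆β (∈-map⁺ W u∈Kc))) ⟩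
    6 + (7 ∸ length Kc)                   ∎)
    where open ≤-Reasoning

  module _ (i : Fin 7) {Kc} (Kc! : Unique Kc) (v∉Kc : lookup β i ∉ map W Kc)
           (Kc⊆β : map W Kc ⊆ toList β) where

    private
      v : GV q
      v = lookup β i
      K : List (GV q)
      K = v ∷ map W Kc

    vertex-budget : ∀ k X → (∀ {d} → d ∉ X → embed k d ∉ K × embed k d ∉ map W Rc) →
                    ∀ {x} → embed k x ≡ v → degreeOutside X x ≤ toℕ i + (6 ∸ length Kc)
    vertex-budget k X new {x} embed≡v = begin
      degreeOutside X x                                  ≤⟨ copy-budget k X K! K⊆β new x ⟩
      countAdj G (embed k x) Q + (7 ∸ length K)
        ≡⟨ cong₂ (λ u l → countAdj G u Q + (6 ∸ l)) embed≡v (length-map W Kc) ⟩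
      countAdj G v Q + (6 ∸ length Kc)                   ≤⟨ +-monoˡ-≤ _ (β-placed i) ⟩
      toℕ i + (6 ∸ length Kc)                            ∎
      where
        open ≤-Reasoning
        K! : Unique K
        K! = All.tabulate (λ u∈ v≡u → v∉Kc (subst (_∈ _) (sym v≡u) u∈)) ∷ map⁺ W-injective Kc!
        K⊆β : K ⊆ toList β
        K⊆β (here refl) = lookup∈toList i β
        K⊆β (there u∈) = Kc⊆β u∈

    -- A vertex below the top copy has 7 neighbours in layers free of known vertices.
    locate-in-top : All (λ d → 3 ≤ layer d) Kc → toℕ i ≤ length Kc → length Kc ≤ 6 →
                    ∃ λ c → W c ≡ v × degreeOutside (c ∷ Kc ++ Rc) c ≤ toℕ i + (6 ∸ length Kc)
    locate-in-top Kc-high i≤Kc Kc≤6 with vertex-cases v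
    ... | inj₁ (c , Wc≡v) = c , Wc≡v , vertex-budget top (c ∷ Kc ++ Rc) new Wc≡v
      where
        new : ∀ {d} → d ∉ c ∷ Kc ++ Rc → W d ∉ K × W d ∉ map W Rc
        new d∉ = (λ { (here Wd≡v) → d∉ (here (W-injective (≡-trans Wd≡v (sym Wc≡v))))
                    ; (there Wd∈) → d∉ (there (∈-++⁺ˡ (∈-map-W⁻ Wd∈))) })
               , (λ Wd∈ → d∉ (there (∈-++⁺ʳ Kc (∈-map-W⁻ Wd∈))))
    ... | inj₂ (k , c , k<p , c-low , embed≡v) = ⊥-elim (<⇒≱ i+slack<7
          (≤-trans (lowerCopy-degree c c-low) (vertex-budget k (c ∷ upperLayers) new embed≡v)))
      where
        i+slack<7 : toℕ i + (6 ∸ length Kc) < 7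
        i+slack<7 = s≤s (≤-trans (+-monoˡ-≤ _ i≤Kc) (≤-reflexive (m+[n∸m]≡n Kc≤6)))
        below : ∀ {d xs} → d ∉ upperLayers → All (λ d → 3 ≤ layer d) xs → embed k d ∉ map W xs
        below d∉ high embed∈ with ∈-map⁻ W embed∈
        ... | e , e∈ , eq = lower-≢-W k k<p (layer≤2-outside-upper d∉) (All.lookup high e∈) eq
        new : ∀ {d} → d ∉ c ∷ upperLayers → embed k d ∉ K × embed k d ∉ map W Rc
        new d∉ = (λ { (here embed≡v′) → d∉ (here (embed-injective k (≡-trans embed≡v′ (sym embed≡v))))
                    ; (there embed∈) → below (λ d∈ → d∉ (there d∈)) Kc-high embed∈ })
               , below (λ d∈ → d∉ (there d∈)) Rc-high

  closedNbhd⊆first : ∀ {c} → W c ≡ lookup β zero → map W (closedNbhdOutside Rc c) ⊆ toList β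
  closedNbhd⊆first {c} Wc≡first u∈ with ∈-map⁻ W u∈
  ... | _ , here refl , refl = subst (_∈ toList β) (sym Wc≡first) (lookup∈toList zero β)
  ... | d , there d∈ , refl with ∈-filter⁻ (λ y → Gadj 2 c y ≟ᵇ true) {xs = GVertices 2 ∖ Rc} d∈
  ...   | d∈∖Rc , c~d with covered (W d)
  ...     | inj₂ (inj₁ Wd∈β) = Wd∈β
  ...     | inj₂ (inj₂ Wd∈R) = ⊥-elim (proj₂ (∈-∖⁻ d∈∖Rc) (∈-map-W⁻ Wd∈R))
  ...     | inj₁ Wd∈Q = ⊥-elim (<⇒≱ (s≤s z≤n) (≤-trans one-earlier (β-placed zero)))
    where
      first~Wd : G (lookup β zero) (W d) ≡ true
      first~Wd = subst (λ u → G u (W d) ≡ true) Wc≡first (≡-trans (Gadj-embed top c d) c~d)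
      one-earlier : 1 ≤ countAdj G (lookup β zero) Q
      one-earlier = length≤countAdj ([] ∷ []) (first~Wd ∷ []) λ { (here refl) → Wd∈Q }

-- The last two blocks

module FinalBlocks (p : ℕ) (P′ : List (GV (suc (suc p)))) (b′ b : Vec (GV (suc (suc p))) 7)
  (distinct  : Unique (P′ ++ toList b′ ++ toList b))
  (complete  : ∀ v → v ∈ P′ ++ toList b′ ++ toList b)
  (b′-placed : ∀ i → countAdj (Gadj (suc (suc p))) (lookup b′ i) P′ ≤ toℕ i)
  (b-placed  : ∀ i → countAdj (Gadj (suc (suc p))) (lookup b i) (P′ ++ toList b′) ≤ toℕ i)
  where

  open Window p

  b′b-unique : Unique (toList b′ ++ toList b)
  b′b-unique = proj₁ (proj₂ (Unique-++⁻ P′ distinct))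

  b′-unique : Unique (toList b′)
  b′-unique = proj₁ (Unique-++⁻ (toList b′) b′b-unique)

  b-unique : Unique (toList b)
  b-unique = proj₁ (proj₂ (Unique-++⁻ (toList b′) b′b-unique))

  b′∩b : ∀ {v} → v ∈ toList b′ → v ∉ toList b
  b′∩b = proj₂ (proj₂ (Unique-++⁻ (toList b′) b′b-unique))

  location : ∀ v → v ∈ P′ ⊎ v ∈ toList b′ ⊎ v ∈ toList b
  location v with ∈-++⁻ P′ (complete v)
  ... | inj₁ v∈P′ = inj₁ v∈P′
  ... | inj₂ v∈b′b = inj₂ (∈-++⁻ (toList b′) v∈b′b)

  LastBlockShape : Set
  LastBlockShape =
    ∃ λ y → y ∈ lastExtras × toList b ⊆ map W (y ∷ topLayer) × map W (y ∷ topLayer) ⊆ toList b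

  module LastBlock where

    covered : ∀ v → v ∈ P′ ++ toList b′ ⊎ v ∈ toList b ⊎ v ∈ map W []
    covered v with location v
    ... | inj₁ v∈P′         = inj₁ (∈-++⁺ˡ v∈P′)
    ... | inj₂ (inj₁ v∈b′)  = inj₁ (∈-++⁺ʳ P′ v∈b′)
    ... | inj₂ (inj₂ v∈b)   = inj₂ (inj₁ v∈b)

    open PlacedBlock p (P′ ++ toList b′) b [] b-placed b-unique covered []

    top⊆b : map W topLayer ⊆ toList b
    top⊆b u∈ with locate-in-top zero [] (λ ()) (λ ()) [] z≤n z≤n | ∈-map⁻ W u∈
    ... | c , Wc≡first , deg | d , d∈ , refl =
      closedNbhd⊆first Wc≡first (∈-map⁺ W (All.lookup (topLayer⊆closedNbhd (lastStart-cases c deg)) d∈))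

    shape-from : (∃ λ y₀ → y₀ ∈ toList b × y₀ ∉ map W topLayer × toList b ⊆ y₀ ∷ map W topLayer) →
                 LastBlockShape
    shape-from (y₀ , y₀∈b , y₀∉top , b⊆) with ∈-toList⇒lookup y₀∈b
    ... | i , refl
      with locate-in-top i topLayer-unique y₀∉top top⊆b topLayer-high (≤-pred (toℕ<n i)) ≤-refl
    ... | c , Wc≡y₀ , deg = c , lastExtra-cases c c∉top deg≤6 , b⊆Wc∷top , Wc∷top⊆b
      where
        deg≤6 : degreeOutside (c ∷ topLayer) c ≤ 6
        deg≤6 = ≤-trans deg (≤-trans (≤-reflexive (+-identityʳ (toℕ i))) (≤-pred (toℕ<n i)))
        c∉top : c ∉ topLayer
        c∉top c∈ = y₀∉top (subst (_∈ _) Wc≡y₀ (∈-map⁺ W c∈))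
        b⊆Wc∷top : toList b ⊆ map W (c ∷ topLayer)
        b⊆Wc∷top v∈ with b⊆ v∈
        ... | here refl = here (sym Wc≡y₀)
        ... | there v∈top = there v∈top
        Wc∷top⊆b : map W (c ∷ topLayer) ⊆ toList b
        Wc∷top⊆b (here refl) = subst (_∈ toList b) (sym Wc≡y₀) y₀∈b
        Wc∷top⊆b (there v∈top) = top⊆b v∈top

    shape : LastBlockShape
    shape = shape-from (extra-element b-unique (map⁺ W-injective topLayer-unique) top⊆b
                          (≡-trans (length-toList b) (cong suc (sym (length-map W topLayer)))))

  module Penultimate {y} (y∈ : y ∈ lastExtras)
                     (b⊆ : toList b ⊆ map W (y ∷ topLayer)) (⊆b : map W (y ∷ topLayer) ⊆ toList b) where

    covered : ∀ v → v ∈ P′ ⊎ v ∈ toList b′ ⊎ v ∈ map W (y ∷ topLayer)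
    covered v with location v
    ... | inj₁ v∈P′         = inj₁ v∈P′
    ... | inj₂ (inj₁ v∈b′)  = inj₂ (inj₁ v∈b′)
    ... | inj₂ (inj₂ v∈b)   = inj₂ (inj₂ (b⊆ v∈b))

    open PlacedBlock p P′ b′ (y ∷ topLayer) b′-placed b′-unique covered (lastExtras-high y∈) public

    known∉b′ : ∀ {d} → d ∈ y ∷ topLayer → W d ∉ toList b′
    known∉b′ d∈ Wd∈b′ = b′∩b Wd∈b′ (⊆b (∈-map⁺ W d∈))

    first∉known : ∀ {c} → W c ≡ lookup b′ zero → c ∉ y ∷ topLayer
    first∉known Wc≡first c∈ =
      known∉b′ c∈ (subst (_∈ toList b′) (sym Wc≡first) (lookup∈toList zero b′))

    first : ∃ λ c → W c ≡ lookup b′ zero × degreeOutside (c ∷ y ∷ topLayer) c ≤ 6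
    first = locate-in-top zero [] (λ ()) (λ ()) [] z≤n z≤n

  -- Here the closed neighbourhood of the first vertex of b′ fills five places of b′; the
  -- second vertex x₂, having at most one earlier neighbour, fits neither inside nor outside it.
  module Exceptional (b⊆ : toList b ⊆ map W exceptionalKnown) (⊆b : map W exceptionalKnown ⊆ toList b)
                     (start≡first : W exceptionalStart ≡ lookup b′ zero) where

    open Penultimate (there (here refl)) b⊆ ⊆b

    x₂ : GV q
    x₂ = lookup b′ (suc zero)

    nbhd⊆b′ : map W exceptionalNbhd ⊆ toList b′
    nbhd⊆b′ = closedNbhd⊆first start≡first

    commonLowerNbrs-in-P′ : ∀ {u} → u ∈ commonLowerNbrs → W u ∈ P′
    commonLowerNbrs-in-P′ {u} u∈ with location (W u)
    ... | inj₁ Wu∈P′ = Wu∈P′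
    ... | inj₂ (inj₂ Wu∈b) = ⊥-elim (All.lookup commonLowerNbrs-unknown u∈ (∈-map-W⁻ (b⊆ Wu∈b)))
    ... | inj₂ (inj₁ Wu∈b′) = ⊥-elim (¬overloaded u∷nbhd⊆b′ (All.lookup commonLowerNbrs-overloaded u∈))
      where
        u∷nbhd⊆b′ : map W (u ∷ exceptionalNbhd) ⊆ toList b′
        u∷nbhd⊆b′ (here refl) = Wu∈b′
        u∷nbhd⊆b′ (there v∈) = nbhd⊆b′ v∈

    second∉nbhd : ∀ {d} → d ∈ exceptionalNbhd → x₂ ≢ W d
    second∉nbhd {d} d∈ x₂≡Wd with exceptional-inside d∈
    ... | inj₁ refl = lookup₀≢lookup₁ b′ b′-unique (≡-trans (sym start≡first) (sym x₂≡Wd))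
    ... | inj₂ (inj₁ 3<deg) = <⇒≱ 3<deg (begin
      degreeOutside (exceptionalNbhd ++ exceptionalKnown) d  ≤⟨ window-budget exceptionalNbhd-unique nbhd⊆b′ d ⟩
      countAdj G (W d) P′ + 2   ≡⟨ cong (λ v → countAdj G v P′ + 2) (sym x₂≡Wd) ⟩
      countAdj G x₂ P′ + 2      ≤⟨ +-monoˡ-≤ 2 (b′-placed (suc zero)) ⟩
      3                         ∎)
      where open ≤-Reasoning
    ... | inj₂ (inj₂ d~commonLowerNbrs) = <⇒≱ (s≤s (b′-placed (suc zero)))
          (length≤countAdj (map⁺ W-injective commonLowerNbrs-unique) x₂~commonLowerNbrs commonLowerNbrs⊆P′)
      where
        x₂~commonLowerNbrs : All (λ v → G x₂ v ≡ true) (map W commonLowerNbrs)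
        x₂~commonLowerNbrs = All.map⁺ (All.map (λ {u} d~u → subst (λ v → G v (W u) ≡ true) (sym x₂≡Wd)
                                                     (≡-trans (Gadj-embed top d u) d~u)) d~commonLowerNbrs)
        commonLowerNbrs⊆P′ : map W commonLowerNbrs ⊆ P′
        commonLowerNbrs⊆P′ v∈ with ∈-map⁻ W v∈
        ... | u , u∈ , refl = commonLowerNbrs-in-P′ u∈

    second-outside-nbhd : x₂ ∉ map W exceptionalNbhd → ⊥
    second-outside-nbhd x₂∉
      with locate-in-top (suc zero) exceptionalNbhd-unique x₂∉ nbhd⊆b′ exceptionalNbhd-high
                                               (s≤s z≤n) (s≤s (s≤s (s≤s (s≤s (s≤s z≤n)))))
    ... | d , Wd≡x₂ , deg≤2 = <⇒≱ (s≤s deg≤2) (exceptional-outside d d∉)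
      where
        d∉ : d ∉ exceptionalNbhd ++ exceptionalKnown
        d∉ d∈ with ∈-++⁻ exceptionalNbhd d∈
        ... | inj₁ d∈nbhd = x₂∉ (subst (_∈ _) Wd≡x₂ (∈-map⁺ W d∈nbhd))
        ... | inj₂ d∈known =
          known∉b′ d∈known (subst (_∈ toList b′) (sym Wd≡x₂) (lookup∈toList (suc zero) b′))

    impossible : ⊥
    impossible with x₂ ∈? map W exceptionalNbhd
    ... | yes x₂∈ = let d , d∈ , x₂≡Wd = ∈-map⁻ W x₂∈ in second∉nbhd d∈ x₂≡Wd
    ... | no x₂∉ = second-outside-nbhd x₂∉

  module _ {y} (y∈ : y ∈ lastExtras)
           (b⊆ : toList b ⊆ map W (y ∷ topLayer)) (⊆b : map W (y ∷ topLayer) ⊆ toList b) where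

    open Penultimate y∈ b⊆ ⊆b

    penultimateStart-impossible : ∀ {c} → W c ≡ lookup b′ zero →
      Overloaded (y ∷ topLayer) (closedNbhdOutside (y ∷ topLayer) c) ⊎
      (y , c) ≡ (exceptionalExtra , exceptionalStart) → ⊥
    penultimateStart-impossible Wc≡first (inj₁ heavy) = ¬overloaded (closedNbhd⊆first Wc≡first) heavy
    penultimateStart-impossible Wc≡first (inj₂ refl) = Exceptional.impossible b⊆ ⊆b Wc≡first

    penultimate-impossible : ⊥
    penultimate-impossible = from-first first
      where
        from-first : (∃ λ c → W c ≡ lookup b′ zero × degreeOutside (c ∷ y ∷ topLayer) c ≤ 6) → ⊥
        from-first (c , Wc≡first , deg) =
          penultimateStart-impossible Wc≡first (penultimateStart-cases y∈ c (first∉known Wc≡first) deg)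

  impossible : ⊥
  impossible = after-last-block LastBlock.shape
    where
      after-last-block : LastBlockShape → ⊥
      after-last-block (y , y∈ , b⊆ , ⊆b) = penultimate-impossible y∈ b⊆ ⊆b

module _ (p : ℕ) where
  open Window p

  noLastTwoBlocks : ∀ {vs} → LastTwoBlocks G 7 1 vs → vs ↭ GVertices q → ⊥
  noLastTwoBlocks blocks vs↭ = FinalBlocks.impossible p prefix penultimate last distinct complete
    (m+1≤1*[1+n]⇒m≤n ∘ penultimate-ok) (m+1≤1*[1+n]⇒m≤n ∘ last-ok)
    where
      open LastTwoBlocks blocks
      split↭ : prefix ++ toList penultimate ++ toList last ↭ GVertices q
      split↭ = subst (_↭ GVertices q) (sym split) vs↭
      distinct : Unique (prefix ++ toList penultimate ++ toList last)
      distinct = Unique-resp-↭ (↭-sym split↭) (GVertices-unique q)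
      complete : ∀ v → v ∈ prefix ++ toList penultimate ++ toList last
      complete v = ∈-resp-↭ (↭-sym split↭) (∈-GVertices q v)

  tooFewBlocks : ∀ (S₁ : List (GV q)) (bs : List (Vec (GV q) 7)) → length S₁ ≤ 7 → length bs ≤ 1 →
                 S₁ ++ concat (map toList bs) ↭ GVertices q → ⊥
  tooFewBlocks S₁ bs S₁≤7 bs≤1 covers = ≤⇒≯ (length-fewBlocks S₁ bs S₁≤7 bs≤1) (begin-strict
    14                                    <⟨ m≤m+n 15 15 ⟩
    30                                    ≡⟨ sym (length-map W (GVertices 2)) ⟩
    length (map W (GVertices 2))
      ≤⟨ length-mono (map⁺ W-injective (GVertices-unique 2)) (λ _ → ∈-GVertices q _) ⟩
    length (GVertices q)                  ≡⟨ sym (↭-length covers) ⟩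
    length (S₁ ++ concat (map toList bs)) ∎)
    where open ≤-Reasoning

  noPartition : ∀ (S₁ : List (GV q)) bs → length S₁ ≤ 7 →
                S₁ ++ concat (map toList bs) ↭ GVertices q →
                OrderedBlocks G 7 1 S₁ bs → ⊥
  noPartition S₁ [] S₁≤7 covers _ = tooFewBlocks S₁ [] S₁≤7 z≤n covers
  noPartition S₁ (b ∷ []) S₁≤7 covers _ = tooFewBlocks S₁ (b ∷ []) S₁≤7 (s≤s z≤n) covers
  noPartition S₁ (b₁ ∷ b₂ ∷ bs) _ covers ordered =
    noLastTwoBlocks (lastTwoBlocks S₁ b₁ b₂ bs ordered) covers

proposition2 : (q : ℕ) → 2 ≤ q → ¬ KDPartition (Gadj q) (GVertices q) 7 1
proposition2 (suc zero) (s≤s ())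
proposition2 (suc (suc p)) _ partition = noPartition p S₁ blocks S₁-size covers ordered
  where open KDPartition partition
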